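{- Let $0<|q|<1$ and $x,y,u,v\in\mathbb{C}$. Then $$\sum_{n=0}^{\infty}v^{\binom{n}{2}}\mathrm{R}_{n}(x,y;u|q)\frac{z^{n}}{(q;q)_{n}}=\sum_{k=0}^{\infty}(uv)^{\binom{k}{2}}\frac{(yz)^{k}}{(q;q)_{k}}\,\mathrm{e}_{q}(v^{k}xz,v).$$
   Context: $(a;q)_n=\prod_{k=0}^{n-1}(1-aq^k)$, $\genfrac{[}{]}{0pt}{}{n}{k}_{q}=\frac{(q;q)_n}{(q;q)_k(q;q)_{n-k}}$, $\mathrm{R}_{n}(x,y;u|q)=\sum_{k=0}^{n}\genfrac{[}{]}{0pt}{}{n}{k}_{q}u^{\binom{k}{2}}x^{n-k}y^{k}$, and $\mathrm{e}_{q}(z,u)=\sum_{n=0}^{\infty}u^{\binom{n}{2}}\frac{z^{n}}{(q;q)_{n}}$ (with $0^0=1$). The identity is understood as an identity of formal power series in $z$. -}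

module Defs where

open import Level using (_⊔_)
open import Data.Nat using (ℕ; zero; suc; _∸_; _<ᵇ_)
open import Data.Nat.Combinatorics using (_C_)
open import Data.Bool using (if_then_else_)
open import Algebra.Bundles using (CommutativeRing)

-- Everything is stated over an arbitrary commutative ring R (generalising ℂ),
-- with formal power series in z represented by their coefficient sequences.
module Series {c ℓ} (R : CommutativeRing c ℓ) where
  open CommutativeRing R public

  pow : Carrier → ℕ → Carrier
  pow a zero    = 1#
  pow a (suc n) = a * pow a n

  choose2 : ℕ → ℕ
  choose2 n = n C 2

  sumTo : ℕ → (ℕ → Carrier) → Carrier
  sumTo zero    f = f 0
  sumTo (suc n) f = sumTo n f + f (suc n)

  qPoch : Carrier → Carrier → ℕ → Carrier
  qPoch a q zero    = 1#
  qPoch a q (suc n) = qPoch a q n * (1# - a * pow q n)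

  qq : Carrier → ℕ → Carrier
  qq q n = qPoch q q n

  -- `inv` is a family of inverses of (q;q)_n (see mainTheorem10's hypothesis);
  -- the Gaussian binomial [n k]_q = (q;q)_n / ((q;q)_k (q;q)_{n-k}) for k ≤ n.
  qBinom : Carrier → (ℕ → Carrier) → ℕ → ℕ → Carrier
  qBinom q inv n k = qq q n * (inv k * inv (n ∸ k))

  Rpoly : Carrier → (ℕ → Carrier) → Carrier → Carrier → Carrier → ℕ → Carrier
  Rpoly q inv x y u n =
    sumTo n (λ k → qBinom q inv n k * (pow u (choose2 k) * (pow x (n ∸ k) * pow y k)))

  PS : Set c
  PS = ℕ → Carrier

  _⋆_ : PS → PS → PS
  (f ⋆ g) n = sumTo n (λ k → f k * g (n ∸ k))

  -- the monomial a z^k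
  mono : Carrier → ℕ → PS
  mono a k n = if (k <ᵇ n) then 0# else (if (n <ᵇ k) then 0# else a)

  -- Sum of a family of series F k, where F k has z-adic order ≥ k
  -- (so the sum converges formally): coefficient N is Σ_{k=0}^{N} [z^N] F k.
  sumFamily : (ℕ → PS) → PS
  sumFamily F N = sumTo N (λ k → F k N)

  -- e_q(w z, v) = Σ_n v^{C(n,2)} (w z)^n / (q;q)_n as a series in z
  eqSeries : (ℕ → Carrier) → Carrier → Carrier → PS
  eqSeries inv w v n = pow v (choose2 n) * (pow w n * inv n)

  lhs : Carrier → (ℕ → Carrier) → Carrier → Carrier → Carrier → Carrier → PS
  lhs q inv x y u v n = pow v (choose2 n) * (Rpoly q inv x y u n * inv n)

  rhs : Carrier → (ℕ → Carrier) → Carrier → Carrier → Carrier → Carrier → PS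
  rhs q inv x y u v =
    sumFamily (λ k →
      mono (pow (u * v) (choose2 k) * (pow y k * inv k)) k
        ⋆ eqSeries inv (pow v k * x) v)

{-# OPTIONS --safe #-}
-- Comparing coefficients of z^N, both sides are sums over k ≤ N. The k-th terms
-- agree because [N k]_q / (q;q)_N = 1 / ((q;q)_k (q;q)_{N-k}) and because
-- C(N,2) = C(k,2) + C(N-k,2) + k(N-k), which splits v^C(N,2) into the factor
-- v^C(k,2) joining u^C(k,2), the factor v^C(N-k,2) of e_q, and the factor
-- (v^k)^(N-k) that rescales the argument x z of e_q into v^k x z.
module Submission where

open import Defs
open import Data.Nat using (ℕ)
open import Algebra.Bundles using (CommutativeRing)

open import Data.Nat as ℕ using (zero; suc; _∸_; _≤_; z≤n; s≤s)
open import Data.Nat.Properties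
  using (m≤n⇒m≤1+n; ≤-refl; m≤n⇒m<n∨m≡n; <⇒≢; >⇒≢; m+[n∸m]≡n)
import Data.Nat.Properties as ℕ
open import Data.Nat.Combinatorics using (_C_; nC1≡n; nCk+nC[k+1]≡[n+1]C[k+1])
open import Data.Nat.Tactic.RingSolver using (solve-∀)
open import Data.Empty using (⊥-elim)
open import Data.Sum using (inj₁; inj₂)
open import Relation.Binary.PropositionalEquality as ≡ using (_≡_; _≢_)
import Relation.Binary.Reasoning.Setoid as SetoidReasoning
import Algebra.Properties.CommutativeSemigroup as CommutativeSemigroupProperties
import Algebra.Solver.CommutativeMonoid as CommutativeMonoidSolver

module _ where
  open import Data.Nat using (_+_; _*_)
  open import Data.Nat.Properties using (+-comm; +-identityʳ)

  [1+n]C2≡nC2+n : ∀ n → suc n C 2 ≡ n C 2 + n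
  [1+n]C2≡nC2+n n = begin
    suc n C 2           ≡⟨ ≡.sym (nCk+nC[k+1]≡[n+1]C[k+1] n 1) ⟩
    n C 1 + n C 2       ≡⟨ +-comm (n C 1) (n C 2) ⟩
    n C 2 + n C 1       ≡⟨ ≡.cong (n C 2 +_) (nC1≡n n) ⟩
    n C 2 + n           ∎
    where open ≡.≡-Reasoning

  [m+n]C2≡mC2+nC2+m*n : ∀ m n → (m + n) C 2 ≡ m C 2 + n C 2 + m * n
  [m+n]C2≡mC2+nC2+m*n zero    n = ≡.sym (+-identityʳ (n C 2))
  [m+n]C2≡mC2+nC2+m*n (suc m) n = begin
    suc (m + n) C 2                         ≡⟨ [1+n]C2≡nC2+n (m + n) ⟩
    (m + n) C 2 + (m + n)                   ≡⟨ ≡.cong (_+ (m + n)) ([m+n]C2≡mC2+nC2+m*n m n) ⟩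
    m C 2 + n C 2 + m * n + (m + n)         ≡⟨ regroup (m C 2) (n C 2) m n ⟩
    (m C 2 + m) + n C 2 + (n + m * n)       ≡⟨ ≡.cong (λ t → t + n C 2 + (n + m * n)) ([1+n]C2≡nC2+n m) ⟨
    suc m C 2 + n C 2 + suc m * n           ∎
    where
    open ≡.≡-Reasoning
    regroup : ∀ a b m n → a + b + m * n + (m + n) ≡ (a + m) + b + (n + m * n)
    regroup = solve-∀

module SeriesLemmas {c ℓ} (R : CommutativeRing c ℓ) where
  open Series R hiding (zero)
  open SetoidReasoning setoid
  open CommutativeSemigroupProperties *-commutativeSemigroup
    using (interchange; xy∙z≈xz∙y)

  pow-+ : ∀ a m n → pow a (m ℕ.+ n) ≈ pow a m * pow a n
  pow-+ a zero    n = sym (*-identityˡ (pow a n))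
  pow-+ a (suc m) n = trans (*-congˡ (pow-+ a m n)) (sym (*-assoc a (pow a m) (pow a n)))

  pow-distrib-* : ∀ a b n → pow (a * b) n ≈ pow a n * pow b n
  pow-distrib-* a b zero    = sym (*-identityˡ 1#)
  pow-distrib-* a b (suc n) =
    trans (*-congˡ (pow-distrib-* a b n)) (interchange a b (pow a n) (pow b n))

  pow-pow : ∀ a k m → pow (pow a k) m ≈ pow a (k ℕ.* m)
  pow-pow a k zero    = reflexive (≡.cong (pow a) (≡.sym (ℕ.*-zeroʳ k)))
  pow-pow a k (suc m) = begin
    pow a k * pow (pow a k) m   ≈⟨ *-congˡ (pow-pow a k m) ⟩
    pow a k * pow a (k ℕ.* m)   ≈⟨ pow-+ a k (k ℕ.* m) ⟨
    pow a (k ℕ.+ k ℕ.* m)       ≡⟨ ≡.cong (pow a) (ℕ.*-suc k m) ⟨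
    pow a (k ℕ.* suc m)         ∎

  sumTo-cong : ∀ n {f g} → (∀ k → k ≤ n → f k ≈ g k) → sumTo n f ≈ sumTo n g
  sumTo-cong zero    f≈g = f≈g 0 z≤n
  sumTo-cong (suc n) f≈g =
    +-cong (sumTo-cong n (λ k k≤n → f≈g k (m≤n⇒m≤1+n k≤n))) (f≈g (suc n) ≤-refl)

  *-distribˡ-sumTo : ∀ n a f → a * sumTo n f ≈ sumTo n (λ k → a * f k)
  *-distribˡ-sumTo zero    a f = refl
  *-distribˡ-sumTo (suc n) a f = trans (distribˡ a _ _) (+-congʳ (*-distribˡ-sumTo n a f))

  *-distribʳ-sumTo : ∀ n a f → sumTo n f * a ≈ sumTo n (λ k → f k * a)
  *-distribʳ-sumTo zero    a f = refl
  *-distribʳ-sumTo (suc n) a f = trans (distribʳ a _ _) (+-congʳ (*-distribʳ-sumTo n a f))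

  sumTo-zero : ∀ n f → (∀ k → k ≤ n → f k ≈ 0#) → sumTo n f ≈ 0#
  sumTo-zero n f f≈0 = trans (sumTo-cong n f≈0) (sumTo-const0 n)
    where
    sumTo-const0 : ∀ n → sumTo n (λ _ → 0#) ≈ 0#
    sumTo-const0 zero    = refl
    sumTo-const0 (suc n) = trans (+-congʳ (sumTo-const0 n)) (+-identityˡ 0#)

  sumTo-single : ∀ {n k} f → k ≤ n → (∀ j → j ≢ k → f j ≈ 0#) → sumTo n f ≈ f k
  sumTo-single {zero}  f z≤n _ = refl
  sumTo-single {suc n} f k≤1+n f≈0 with m≤n⇒m<n∨m≡n k≤1+n
  ... | inj₁ (s≤s k≤n) =
    trans (+-cong (sumTo-single f k≤n f≈0) (f≈0 (suc n) (>⇒≢ (s≤s k≤n)))) (+-identityʳ _)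
  ... | inj₂ ≡.refl =
    trans (+-congʳ (sumTo-zero n f (λ j j≤n → f≈0 j (<⇒≢ (s≤s j≤n))))) (+-identityˡ _)

  mono-diag : ∀ a k → mono a k k ≡ a
  mono-diag a zero    = ≡.refl
  mono-diag a (suc k) = mono-diag a k

  mono-offDiag : ∀ a k j → j ≢ k → mono a k j ≡ 0#
  mono-offDiag a zero    zero    j≢k = ⊥-elim (j≢k ≡.refl)
  mono-offDiag a zero    (suc j) _   = ≡.refl
  mono-offDiag a (suc k) zero    _   = ≡.refl
  mono-offDiag a (suc k) (suc j) j≢k = mono-offDiag a k j (λ j≡k → j≢k (≡.cong suc j≡k))

  mono-⋆ : ∀ a k f {N} → k ≤ N → (mono a k ⋆ f) N ≈ a * f (N ∸ k)
  mono-⋆ a k f {N} k≤N = begin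
    sumTo N (λ j → mono a k j * f (N ∸ j))  ≈⟨ sumTo-single _ k≤N vanish ⟩
    mono a k k * f (N ∸ k)                  ≡⟨ ≡.cong (λ t → t * f (N ∸ k)) (mono-diag a k) ⟩
    a * f (N ∸ k)                           ∎
    where
    vanish : ∀ j → j ≢ k → mono a k j * f (N ∸ j) ≈ 0#
    vanish j j≢k = trans (*-congʳ (reflexive (mono-offDiag a k j j≢k))) (zeroˡ _)

  qBinom*inv : ∀ q inv → (∀ n → qq q n * inv n ≈ 1#) →
               ∀ n k → qBinom q inv n k * inv n ≈ inv k * inv (n ∸ k)
  qBinom*inv q inv qq*inv≈1 n k = begin
    qq q n * (inv k * inv (n ∸ k)) * inv n   ≈⟨ xy∙z≈xz∙y (qq q n) _ (inv n) ⟩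
    qq q n * inv n * (inv k * inv (n ∸ k))   ≈⟨ *-congʳ (qq*inv≈1 n) ⟩
    1# * (inv k * inv (n ∸ k))               ≈⟨ *-identityˡ _ ⟩
    inv k * inv (n ∸ k)                      ∎

  pow-choose2-split : ∀ v {k N} → k ≤ N →
    pow v (choose2 N) ≈ pow v (choose2 k) * pow v (choose2 (N ∸ k)) * pow (pow v k) (N ∸ k)
  pow-choose2-split v {k} {N} k≤N = begin
    pow v (N C 2)
      ≡⟨ ≡.cong (λ n → pow v (n C 2)) (m+[n∸m]≡n k≤N) ⟨
    pow v ((k ℕ.+ m) C 2)
      ≡⟨ ≡.cong (pow v) ([m+n]C2≡mC2+nC2+m*n k m) ⟩
    pow v (k C 2 ℕ.+ m C 2 ℕ.+ k ℕ.* m)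
      ≈⟨ pow-+ v (k C 2 ℕ.+ m C 2) (k ℕ.* m) ⟩
    pow v (k C 2 ℕ.+ m C 2) * pow v (k ℕ.* m)
      ≈⟨ *-cong (pow-+ v (k C 2) (m C 2)) (sym (pow-pow v k m)) ⟩
    pow v (k C 2) * pow v (m C 2) * pow (pow v k) m
      ∎
    where m = N ∸ k

  module Coefficients (q : Carrier) (inv : ℕ → Carrier)
                      (qq*inv≈1 : ∀ n → qq q n * inv n ≈ 1#) (x y u v : Carrier) where

    rhsWeight : ℕ → Carrier
    rhsWeight k = pow (u * v) (choose2 k) * (pow y k * inv k)

    rhsFactor : ℕ → PS
    rhsFactor k = eqSeries inv (pow v k * x) v

    lhs-summand≈rhs-summand : ∀ {N k} → k ≤ N →
      pow v (choose2 N) * (qBinom q inv N k * (pow u (choose2 k) * (pow x (N ∸ k) * pow y k)) * inv N)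
        ≈ rhsWeight k * rhsFactor k (N ∸ k)
    lhs-summand≈rhs-summand {N} {k} k≤N = begin
      pow v (N C 2) * (qBinom q inv N k * (U * (X * Y)) * inv N)
        ≈⟨ *-congˡ (xy∙z≈xz∙y (qBinom q inv N k) (U * (X * Y)) (inv N)) ⟩
      pow v (N C 2) * (qBinom q inv N k * inv N * (U * (X * Y)))
        ≈⟨ *-cong (pow-choose2-split v k≤N) (*-congʳ (qBinom*inv q inv qq*inv≈1 N k)) ⟩
      Vk * Vm * W * (Ik * Im * (U * (X * Y)))
        ≈⟨ rearrange Vk Vm W Ik Im U X Y ⟩
      U * Vk * (Y * Ik) * (Vm * (W * X * Im))
        ≈⟨ *-cong (*-congʳ (pow-distrib-* u v (k C 2))) (*-congˡ (*-congʳ (pow-distrib-* (pow v k) x m))) ⟨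
      rhsWeight k * rhsFactor k m
        ∎
      where
      m = N ∸ k
      U = pow u (k C 2)
      X = pow x m
      Y = pow y k
      Vk = pow v (k C 2)
      Vm = pow v (m C 2)
      W = pow (pow v k) m
      Ik = inv k
      Im = inv m
      open CommutativeMonoidSolver *-commutativeMonoid using (solve; _⊜_; _⊕_)
      rearrange : ∀ vk vm w ik im a b c →
        vk * vm * w * (ik * im * (a * (b * c))) ≈ a * vk * (c * ik) * (vm * (w * b * im))
      rearrange = solve 8 (λ vk vm w ik im a b c →
        ((vk ⊕ vm) ⊕ w) ⊕ ((ik ⊕ im) ⊕ (a ⊕ (b ⊕ c))) ⊜ ((a ⊕ vk) ⊕ (c ⊕ ik)) ⊕ (vm ⊕ ((w ⊕ b) ⊕ im))) refl

mainTheorem10 : ∀ {c ℓ} (R : CommutativeRing c ℓ) →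
    let open Series R in
    (q : Carrier) (inv : ℕ → Carrier) →
    (∀ n → qq q n * inv n ≈ 1#) →
    (x y u v : Carrier) →
    ∀ N → lhs q inv x y u v N ≈ rhs q inv x y u v N
mainTheorem10 R q inv qq*inv≈1 x y u v N = begin
  pow v (choose2 N) * (sumTo N lhsSummand * inv N)
    ≈⟨ *-congˡ (*-distribʳ-sumTo N (inv N) lhsSummand) ⟩
  pow v (choose2 N) * sumTo N (λ k → lhsSummand k * inv N)
    ≈⟨ *-distribˡ-sumTo N (pow v (choose2 N)) _ ⟩
  sumTo N (λ k → pow v (choose2 N) * (lhsSummand k * inv N))
    ≈⟨ sumTo-cong N (λ k k≤N → lhs-summand≈rhs-summand k≤N) ⟩
  sumTo N (λ k → rhsWeight k * rhsFactor k (N ∸ k))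
    ≈⟨ sumTo-cong N (λ k k≤N → mono-⋆ (rhsWeight k) k (rhsFactor k) k≤N) ⟨
  rhs q inv x y u v N
    ∎
  where
  open Series R hiding (zero)
  open SetoidReasoning setoid
  open SeriesLemmas R
  open Coefficients q inv qq*inv≈1 x y u v
  lhsSummand : ℕ → Carrier
  lhsSummand k = qBinom q inv N k * (pow u (choose2 k) * (pow x (N ∸ k) * pow y k))
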